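{- For nonnegative integers $\lambda_1\ge\lambda_2$, $$F_{(\lambda_1)}(q)=[2]^{\lambda_1},\qquad F_{(\lambda_1,\lambda_2)}(q)=-q^{ -1}[2]^{\lambda_1}+q^{ -1}[2]^{\lambda_1-\lambda_2+1}[3]^{\lambda_2}.$$
   Context: For an integer $m\ge0$, $[m]=1+q+\dots+q^{m-1}$. For a weakly decreasing sequence $\lambda=(\lambda_1,\dots,\lambda_k)$ of nonnegative integers, $Y_\lambda$ is the left-justified Young diagram with $\lambda_i$ boxes in row $i$ (rows top to bottom). A Le-filling of $Y_\lambda$ is a map $D:Y_\lambda\to\{0,1\}$ such that no box filled with $0$ has a box filled with $1$ above it in the same column and a box filled with $1$ to its left in the same row. $F_\lambda(q)=\sum_D q^{\#\{\text{boxes filled with }1\}}$, summed over all Le-fillings $D$ of $Y_\lambda$. -}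

module Defs where

open import Data.Nat as ℕ using (ℕ; zero; suc; _∸_)
open import Data.Integer as ℤ using (ℤ; +_)
open import Data.Bool using (Bool; true; false; _∧_; _∨_; not; if_then_else_)
open import Data.List using (List; []; _∷_; map; concatMap; filter; foldr; length; take; drop; reverse)
open import Data.List.Relation.Unary.Any using (Any)
open import Relation.Binary.PropositionalEquality using (_≡_)
open import Relation.Nullary.Decidable using (T?)
open import Data.Bool using (T)

-- Formal power series / polynomials over ℤ, as coefficient functions.
-- (All series below have finite support, i.e. are polynomials.)

Poly : Set
Poly = ℕ → ℤ

_≐_ : Poly → Poly → Set
p ≐ r = ∀ n → p n ≡ r n
infix 4 _≐_

0P : Poly
0P _ = + 0

1P : Poly
1P zero    = + 1
1P (suc _) = + 0

X : Poly
X (suc zero) = + 1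
X _          = + 0

_⊕_ : Poly → Poly → Poly
(p ⊕ r) n = p n ℤ.+ r n
infixl 6 _⊕_

⊖_ : Poly → Poly
(⊖ p) n = ℤ.- (p n)

conv : Poly → Poly → ℕ → ℕ → ℤ
conv p r n zero    = p 0 ℤ.* r n
conv p r n (suc i) = p (suc i) ℤ.* r (n ∸ suc i) ℤ.+ conv p r n i

_⊗_ : Poly → Poly → Poly
(p ⊗ r) n = conv p r n n
infixl 7 _⊗_

_^P_ : Poly → ℕ → Poly
p ^P zero  = 1P
p ^P suc k = p ⊗ (p ^P k)

qint : ℕ → Poly
qint m n = if n ℕ.<ᵇ m then + 1 else + 0

-- Laurent polynomials: a pair (k , p) denotes q^{-k} · p.

record Laurent : Set where
  constructor _⸴_
  field
    negShift : ℕ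
    body     : Poly

-- q^{-k} p = q^{-k'} p'  iff  q^{k'} p = q^{k} p'
_≈L_ : Laurent → Laurent → Set
(k ⸴ p) ≈L (k' ⸴ p') = (X ^P k') ⊗ p ≐ (X ^P k) ⊗ p'
infix 4 _≈L_

ι : Poly → Laurent
ι p = 0 ⸴ p

qinv : Laurent
qinv = 1 ⸴ 1P

_+L_ : Laurent → Laurent → Laurent
(k ⸴ p) +L (k' ⸴ p') = (k ℕ.+ k') ⸴ ((X ^P k') ⊗ p ⊕ (X ^P k) ⊗ p')
infixl 6 _+L_

_*L_ : Laurent → Laurent → Laurent
(k ⸴ p) *L (k' ⸴ p') = (k ℕ.+ k') ⸴ (p ⊗ p')
infixl 7 _*L_

-L_ : Laurent → Laurent
-L (k ⸴ p) = k ⸴ (⊖ p)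

-- A partition λ = (λ₁,…,λ_k) is a List ℕ (weak decrease is a hypothesis
-- of the statements that use it).  A filling of Y_λ is a list of rows,
-- row i being a List Bool of length λ_i  (true = 1, false = 0).

Filling : Set
Filling = List (List Bool)

words : ℕ → List (List Bool)
words zero    = [] ∷ []
words (suc n) = concatMap (λ w → (false ∷ w) ∷ (true ∷ w) ∷ []) (words n)

fillings : List ℕ → List Filling
fillings []      = [] ∷ []
fillings (m ∷ ms) = concatMap (λ w → map (w ∷_) (fillings ms)) (words m)

-- j-th entry of a row (false if absent)
entry : List Bool → ℕ → Bool
entry []      _       = false
entry (b ∷ _) zero    = b
entry (_ ∷ w) (suc j) = entry w j

anyB : List Bool → Bool
anyB = foldr _∨_ false

allB : List Bool → Bool
allB = foldr _∧_ true

oneAbove : List (List Bool) → ℕ → Bool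
oneAbove above j = anyB (map (λ w → entry w j) above)

-- check one row, given the rows above it; `seen` records whether a 1
-- has already occurred to the left in this row; j is the column index.
rowOK : List (List Bool) → Bool → ℕ → List Bool → Bool
rowOK above seen j []          = true
rowOK above seen j (true  ∷ w) = rowOK above true (suc j) w
rowOK above seen j (false ∷ w) =
  not (seen ∧ oneAbove above j) ∧ rowOK above seen (suc j) w

-- Le-condition: no 0 with a 1 above it in its column and a 1 to its left
-- in its row.  `above` accumulates the rows already processed.
leOK' : List (List Bool) → Filling → Bool
leOK' above []      = true
leOK' above (w ∷ D) = rowOK above false 0 w ∧ leOK' (w ∷ above) D

isLe : Filling → Bool
isLe = leOK' []

countOnes : Filling → ℕ
countOnes D = foldr ℕ._+_ 0 (map (λ w → length (filter (λ b → T? b) w)) D)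

sumP : List Poly → Poly
sumP = foldr _⊕_ 0P

F : List ℕ → Poly
F ls = sumP (map (λ D → X ^P countOnes D) (filter (λ D → T? (isLe D)) (fillings ls)))

-- One row: every 0/1 word is a Le-filling, so F_(m) = Σ_w q^{#1 in w} = [2]^m.
--
-- Two rows: the top row is unconstrained, and a 0 in the lower row is forbidden exactly when it
-- sits under a 1 and a 1 occurs to its left. So after stripping the first column (top, bottom) of
-- a filling, admissibility of the rest depends only on whether the lower row has seen a 1. Writing
-- T(m, n) and S(m, n) for the generating functions with and without that flag set
-- (pairSum true and pairSum false), the columns 00, 01, 10, 11 contribute
--   T(m+1, n+1) = (1 + q + 0 + q²) T(m, n) = [3] T(m, n),
--   S(m+1, n+1) = S + q T + q S + q² T = [2] (S(m, n) + q T(m, n)),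
-- with S(m, 0) = T(m, 0) = [2]^m. Induction on k then gives T(k+d, k) = [2]^d [3]^k and
-- [2]^(k+d) + q S(k+d, k) = [2]^(d+1) [3]^k, which is the two-row formula multiplied by q.

module Submission where

open import Defs
open import Data.Nat using (ℕ; _≥_; _∸_; _+_)
open import Data.List using (List; []; _∷_)
open import Data.Product using (_×_)

open import Algebra.Bundles using (AbelianGroup)
open import Algebra.Construct.Pointwise ℕ using (abelianGroup)
open import Data.Bool using (Bool; true; false; if_then_else_; not; _∧_; _∨_)
import Data.Bool.Properties as Bool
open import Data.Integer as ℤ using (ℤ; +_)
import Data.Integer.Properties as ℤ
open import Data.List using (map; concatMap; filter; length; _++_)
open import Data.Nat using (zero; suc; _<_; _≤_; s≤s)
import Data.Nat.Properties as ℕ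
open import Data.Product using (_,_)
open import Relation.Binary.PropositionalEquality
  using (_≡_; refl; sym; cong; cong₂; trans)
open import Relation.Nullary.Decidable using (T?)
open import Algebra.Properties.CommutativeSemigroup ℤ.+-commutativeSemigroup
  using () renaming (interchange to +-interchange)

-- The pointwise lift of (ℤ, +): its carrier, operations and equality are definitionally
-- Poly, _⊕_, 0P, ⊖_ and _≐_.
polyGroup : AbelianGroup _ _
polyGroup = abelianGroup ℤ.+-0-abelianGroup

open AbelianGroup polyGroup
  using (setoid)
  renaming ( refl to ≐-refl; sym to ≐-sym; trans to ≐-trans
           ; ∙-cong to ⊕-cong; assoc to ⊕-assoc
           ; identityˡ to ⊕-identityˡ; identityʳ to ⊕-identityʳ; ⁻¹-cong to ⊖-cong)
open import Algebra.Properties.AbelianGroup polyGroup using (y≈x\\z)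
open import Algebra.Properties.CommutativeSemigroup (AbelianGroup.commutativeSemigroup polyGroup)
  using () renaming (interchange to ⊕-interchange)
open import Relation.Binary.Reasoning.Setoid setoid

-- The fixed summand is explicit: unification cannot recover p from p n ℤ.+ r n.
⊕-congˡ : ∀ p {r s} → r ≐ s → p ⊕ r ≐ p ⊕ s
⊕-congˡ p r≐s n = cong (λ x → p n ℤ.+ x) (r≐s n)

⊕-congʳ : ∀ r {p s} → p ≐ s → p ⊕ r ≐ s ⊕ r
⊕-congʳ r p≐s n = cong (λ x → x ℤ.+ r n) (p≐s n)

infixr 8 q·_ [2]·_ [3]·_

q·_ : Poly → Poly
(q· p) zero    = + 0
(q· p) (suc n) = p n

q·-cong : ∀ {p r} → p ≐ r → q· p ≐ q· r
q·-cong p≐r zero    = refl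
q·-cong p≐r (suc n) = p≐r n

q·-⊕ : ∀ p r → q· (p ⊕ r) ≐ q· p ⊕ q· r
q·-⊕ p r zero    = refl
q·-⊕ p r (suc n) = refl

q·-0P : q· 0P ≐ 0P
q·-0P zero    = refl
q·-0P (suc n) = refl

-- [2]· p = (1 + q) p and [3]· p = (1 + q + q²) p, written with shifts so that associativity
-- of the Cauchy product is never needed.
[2]·_ : Poly → Poly
[2]· p = p ⊕ q· p

[3]·_ : Poly → Poly
[3]· p = [2]· p ⊕ q· q· p

[2]·-cong : ∀ {p r} → p ≐ r → [2]· p ≐ [2]· r
[2]·-cong p≐r = ⊕-cong p≐r (q·-cong p≐r)

[3]·-cong : ∀ {p r} → p ≐ r → [3]· p ≐ [3]· r
[3]·-cong p≐r = ⊕-cong ([2]·-cong p≐r) (q·-cong (q·-cong p≐r))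

[2]·-⊕ : ∀ p r → [2]· (p ⊕ r) ≐ [2]· p ⊕ [2]· r
[2]·-⊕ p r = ≐-trans (⊕-congˡ (p ⊕ r) (q·-⊕ p r)) (⊕-interchange p r (q· p) (q· r))

q·-[2]· : ∀ p → q· [2]· p ≐ [2]· q· p
q·-[2]· p = q·-⊕ p (q· p)

[3]·[2]· : ∀ p → [3]· [2]· p ≐ [2]· ([2]· p ⊕ q· q· p)
[3]·[2]· p = ≐-sym (begin
  [2]· ([2]· p ⊕ q· q· p)     ≈⟨ [2]·-⊕ ([2]· p) (q· q· p) ⟩
  [2]· [2]· p ⊕ [2]· q· q· p  ≈⟨ ⊕-congˡ ([2]· [2]· p) (≐-sym (≐-trans (q·-cong (q·-[2]· p)) (q·-[2]· (q· p)))) ⟩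
  [3]· [2]· p                 ∎)

conv-cong : ∀ {p p' r r'} → p ≐ p' → r ≐ r' → ∀ n i → conv p r n i ≡ conv p' r' n i
conv-cong p≐p' r≐r' n zero    = cong₂ ℤ._*_ (p≐p' 0) (r≐r' n)
conv-cong p≐p' r≐r' n (suc i) =
  cong₂ ℤ._+_ (cong₂ ℤ._*_ (p≐p' (suc i)) (r≐r' (n ∸ suc i))) (conv-cong p≐p' r≐r' n i)

⊗-cong : ∀ {p p' r r'} → p ≐ p' → r ≐ r' → p ⊗ r ≐ p' ⊗ r'
⊗-cong p≐p' r≐r' n = conv-cong p≐p' r≐r' n n

conv-distribʳ : ∀ p p' r n i → conv (p ⊕ p') r n i ≡ conv p r n i ℤ.+ conv p' r n i
conv-distribʳ p p' r n zero    = ℤ.*-distribʳ-+ (r n) (p 0) (p' 0)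
conv-distribʳ p p' r n (suc i) = trans
  (cong₂ ℤ._+_ (ℤ.*-distribʳ-+ (r (n ∸ suc i)) (p (suc i)) (p' (suc i))) (conv-distribʳ p p' r n i))
  (+-interchange (p (suc i) ℤ.* r (n ∸ suc i)) (p' (suc i) ℤ.* r (n ∸ suc i))
                 (conv p r n i) (conv p' r n i))

conv-distribˡ : ∀ p r r' n i → conv p (r ⊕ r') n i ≡ conv p r n i ℤ.+ conv p r' n i
conv-distribˡ p r r' n zero    = ℤ.*-distribˡ-+ (p 0) (r n) (r' n)
conv-distribˡ p r r' n (suc i) = trans
  (cong₂ ℤ._+_ (ℤ.*-distribˡ-+ (p (suc i)) (r (n ∸ suc i)) (r' (n ∸ suc i))) (conv-distribˡ p r r' n i))
  (+-interchange (p (suc i) ℤ.* r (n ∸ suc i)) (p (suc i) ℤ.* r' (n ∸ suc i))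
                 (conv p r n i) (conv p r' n i))

⊗-distribʳ-⊕ : ∀ r p p' → (p ⊕ p') ⊗ r ≐ p ⊗ r ⊕ p' ⊗ r
⊗-distribʳ-⊕ r p p' n = conv-distribʳ p p' r n n

⊗-distribˡ-⊕ : ∀ p r r' → p ⊗ (r ⊕ r') ≐ p ⊗ r ⊕ p ⊗ r'
⊗-distribˡ-⊕ p r r' n = conv-distribˡ p r r' n n

conv-identityˡ : ∀ r n i → conv 1P r n i ≡ r n
conv-identityˡ r n zero    = ℤ.*-identityˡ (r n)
conv-identityˡ r n (suc i) =
  trans (cong₂ ℤ._+_ (ℤ.*-zeroˡ (r (n ∸ suc i))) (conv-identityˡ r n i)) (ℤ.+-identityˡ (r n))

⊗-identityˡ : ∀ r → 1P ⊗ r ≐ r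
⊗-identityˡ r n = conv-identityˡ r n n

1P-at-∸ : ∀ {n i} → i < n → 1P (n ∸ i) ≡ + 0
1P-at-∸ {suc n} {zero}  _         = refl
1P-at-∸ {suc n} {suc i} (s≤s i<n) = 1P-at-∸ i<n

conv-1P-below : ∀ p {n} i → i < n → conv p 1P n i ≡ + 0
conv-1P-below p zero    (s≤s _) = ℤ.*-zeroʳ (p 0)
conv-1P-below p (suc i) 1+i<n   = trans
  (cong₂ ℤ._+_ (cong (p (suc i) ℤ.*_) (1P-at-∸ 1+i<n))
               (conv-1P-below p i (ℕ.<-trans (ℕ.n<1+n i) 1+i<n)))
  (trans (ℤ.+-identityʳ _) (ℤ.*-zeroʳ (p (suc i))))

⊗-identityʳ : ∀ p → p ⊗ 1P ≐ p
⊗-identityʳ p zero    = ℤ.*-identityʳ (p 0)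
⊗-identityʳ p (suc n) = trans
  (cong₂ ℤ._+_ (cong (λ k → p (suc n) ℤ.* 1P k) (ℕ.n∸n≡0 n))
               (conv-1P-below p n (ℕ.n<1+n n)))
  (trans (ℤ.+-identityʳ _) (ℤ.*-identityʳ (p (suc n))))

conv-q·ˡ : ∀ p r n i → conv (q· p) r (suc n) (suc i) ≡ conv p r n i
conv-q·ˡ p r n zero    =
  trans (cong (λ x → p 0 ℤ.* r n ℤ.+ x) (ℤ.*-zeroˡ (r (suc n)))) (ℤ.+-identityʳ _)
conv-q·ˡ p r n (suc i) = cong (λ x → p (suc i) ℤ.* r (n ∸ suc i) ℤ.+ x) (conv-q·ˡ p r n i)

q·-⊗ : ∀ p r → q· p ⊗ r ≐ q· (p ⊗ r)
q·-⊗ p r zero    = ℤ.*-zeroˡ (r 0)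
q·-⊗ p r (suc n) = conv-q·ˡ p r n n

q·-at-∸ : ∀ r {n i} → i < n → (q· r) (n ∸ i) ≡ r (n ∸ suc i)
q·-at-∸ r {suc n} {zero}  _         = refl
q·-at-∸ r {suc n} {suc i} (s≤s i<n) = q·-at-∸ r i<n

conv-q·ʳ : ∀ p r n i → i ≤ n → conv p (q· r) (suc n) i ≡ conv p r n i
conv-q·ʳ p r n zero    _     = refl
conv-q·ʳ p r n (suc i) 1+i≤n = cong₂ ℤ._+_
  (cong (p (suc i) ℤ.*_) (q·-at-∸ r 1+i≤n))
  (conv-q·ʳ p r n i (ℕ.<⇒≤ 1+i≤n))

⊗-q· : ∀ p r → p ⊗ q· r ≐ q· (p ⊗ r)
⊗-q· p r zero    = ℤ.*-zeroʳ (p 0)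
⊗-q· p r (suc n) = trans
  (cong₂ ℤ._+_ (cong (λ k → p (suc n) ℤ.* (q· r) k) (ℕ.n∸n≡0 n)) (conv-q·ʳ p r n n ℕ.≤-refl))
  (trans (cong (ℤ._+ conv p r n n) (ℤ.*-zeroʳ (p (suc n)))) (ℤ.+-identityˡ _))

[2]·-⊗ : ∀ p r → [2]· p ⊗ r ≐ [2]· (p ⊗ r)
[2]·-⊗ p r = ≐-trans (⊗-distribʳ-⊕ r p (q· p)) (⊕-congˡ (p ⊗ r) (q·-⊗ p r))

⊗-[2]· : ∀ p r → p ⊗ [2]· r ≐ [2]· (p ⊗ r)
⊗-[2]· p r = ≐-trans (⊗-distribˡ-⊕ p r (q· r)) (⊕-congˡ (p ⊗ r) (⊗-q· p r))

[3]·-⊗ : ∀ p r → [3]· p ⊗ r ≐ [3]· (p ⊗ r)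
[3]·-⊗ p r = begin
  [3]· p ⊗ r                    ≈⟨ ⊗-distribʳ-⊕ r ([2]· p) (q· q· p) ⟩
  [2]· p ⊗ r ⊕ q· q· p ⊗ r      ≈⟨ ⊕-cong ([2]·-⊗ p r) (≐-trans (q·-⊗ (q· p) r) (q·-cong (q·-⊗ p r))) ⟩
  [3]· (p ⊗ r)                  ∎

⊗-[3]· : ∀ p r → p ⊗ [3]· r ≐ [3]· (p ⊗ r)
⊗-[3]· p r = begin
  p ⊗ [3]· r                    ≈⟨ ⊗-distribˡ-⊕ p ([2]· r) (q· q· r) ⟩
  p ⊗ [2]· r ⊕ p ⊗ q· q· r      ≈⟨ ⊕-cong (⊗-[2]· p r) (≐-trans (⊗-q· p (q· r)) (q·-cong (⊗-q· p r))) ⟩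
  [3]· (p ⊗ r)                  ∎

X≐q·1P : X ≐ q· 1P
X≐q·1P zero          = refl
X≐q·1P (suc zero)    = refl
X≐q·1P (suc (suc n)) = refl

X-⊗ : ∀ p → X ⊗ p ≐ q· p
X-⊗ p = ≐-trans (⊗-cong X≐q·1P (≐-refl {p})) (≐-trans (q·-⊗ 1P p) (q·-cong (⊗-identityˡ p)))

X^P-suc-⊗ : ∀ k p → X ^P suc k ⊗ p ≐ q· (X ^P k ⊗ p)
X^P-suc-⊗ k p = ≐-trans (⊗-cong (X-⊗ (X ^P k)) (≐-refl {p})) (q·-⊗ (X ^P k) p)

qint2≐[2]·1P : qint 2 ≐ [2]· 1P
qint2≐[2]·1P zero          = refl
qint2≐[2]·1P (suc zero)    = refl
qint2≐[2]·1P (suc (suc n)) = refl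

qint3≐[3]·1P : qint 3 ≐ [3]· 1P
qint3≐[3]·1P zero                = refl
qint3≐[3]·1P (suc zero)          = refl
qint3≐[3]·1P (suc (suc zero))    = refl
qint3≐[3]·1P (suc (suc (suc n))) = refl

qint2-⊗ : ∀ p → qint 2 ⊗ p ≐ [2]· p
qint2-⊗ p = ≐-trans (⊗-cong qint2≐[2]·1P (≐-refl {p})) (≐-trans ([2]·-⊗ 1P p) ([2]·-cong (⊗-identityˡ p)))

qint3-⊗ : ∀ p → qint 3 ⊗ p ≐ [3]· p
qint3-⊗ p = ≐-trans (⊗-cong qint3≐[3]·1P (≐-refl {p})) (≐-trans ([3]·-⊗ 1P p) ([3]·-cong (⊗-identityˡ p)))

qint2^suc-⊗ : ∀ a p → qint 2 ^P suc a ⊗ p ≐ [2]· (qint 2 ^P a ⊗ p)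
qint2^suc-⊗ a p = ≐-trans (⊗-cong (qint2-⊗ (qint 2 ^P a)) (≐-refl {p})) ([2]·-⊗ (qint 2 ^P a) p)

⊗-qint3^suc : ∀ p k → p ⊗ qint 3 ^P suc k ≐ [3]· (p ⊗ qint 3 ^P k)
⊗-qint3^suc p k = ≐-trans (⊗-cong (≐-refl {p}) (qint3-⊗ (qint 3 ^P k))) (⊗-[3]· p (qint 3 ^P k))

a⊕q·p≐b⇒p≈q⁻¹[b-a] : ∀ p a b → a ⊕ q· p ≐ b → ι p ≈L (-L (qinv *L ι a)) +L qinv *L ι b
a⊕q·p≐b⇒p≈q⁻¹[b-a] p a b a⊕q·p≐b = begin
  X ^P 2 ⊗ p
    ≈⟨ X^P-suc-⊗ 1 p ⟩
  q· (X ^P 1 ⊗ p)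
    ≈⟨ q·-cong (X¹-⊗ p) ⟩
  q· q· p
    ≈⟨ q·-cong (y≈x\\z a (q· p) b a⊕q·p≐b) ⟩
  q· (⊖ a ⊕ b)
    ≈⟨ q·-⊕ (⊖ a) b ⟩
  q· ⊖ a ⊕ q· b
    ≈⟨ ≐-sym (⊕-cong (q·-cong (⊖-cong (⊗-identityˡ a))) (q·-cong (⊗-identityˡ b))) ⟩
  q· ⊖ (1P ⊗ a) ⊕ q· (1P ⊗ b)
    ≈⟨ ≐-sym (⊕-cong (X¹-⊗ (⊖ (1P ⊗ a))) (X¹-⊗ (1P ⊗ b))) ⟩
  X ^P 1 ⊗ ⊖ (1P ⊗ a) ⊕ X ^P 1 ⊗ (1P ⊗ b)
    ≈⟨ ≐-sym (⊗-identityˡ (X ^P 1 ⊗ ⊖ (1P ⊗ a) ⊕ X ^P 1 ⊗ (1P ⊗ b))) ⟩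
  X ^P 0 ⊗ (X ^P 1 ⊗ ⊖ (1P ⊗ a) ⊕ X ^P 1 ⊗ (1P ⊗ b)) ∎
  where
  X¹-⊗ : ∀ r → X ^P 1 ⊗ r ≐ q· r
  X¹-⊗ r = ≐-trans (X^P-suc-⊗ 0 r) (q·-cong (⊗-identityˡ r))

-- Sums over words and fillings

∑ : {A : Set} → (A → Poly) → List A → Poly
∑ f xs = sumP (map f xs)

∑-cong : {A : Set} {f g : A → Poly} (xs : List A) → (∀ x → f x ≐ g x) → ∑ f xs ≐ ∑ g xs
∑-cong []       f≐g = ≐-refl
∑-cong (x ∷ xs) f≐g = ⊕-cong (f≐g x) (∑-cong xs f≐g)

∑-++ : {A : Set} (f : A → Poly) (xs ys : List A) → ∑ f (xs ++ ys) ≐ ∑ f xs ⊕ ∑ f ys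
∑-++ f []       ys = ≐-sym (⊕-identityˡ (∑ f ys))
∑-++ f (x ∷ xs) ys =
  ≐-trans (⊕-congˡ (f x) (∑-++ f xs ys)) (≐-sym (⊕-assoc (f x) (∑ f xs) (∑ f ys)))

∑-concatMap : {A B : Set} (f : B → Poly) (g : A → List B) (xs : List A) →
              ∑ f (concatMap g xs) ≐ ∑ (λ x → ∑ f (g x)) xs
∑-concatMap f g []       = ≐-refl
∑-concatMap f g (x ∷ xs) =
  ≐-trans (∑-++ f (g x) (concatMap g xs)) (⊕-congˡ (∑ f (g x)) (∑-concatMap f g xs))

∑-map : {A B : Set} (f : B → Poly) (g : A → B) (xs : List A) → ∑ f (map g xs) ≐ ∑ (λ x → f (g x)) xs
∑-map f g []       = ≐-refl
∑-map f g (x ∷ xs) = ⊕-congˡ (f (g x)) (∑-map f g xs)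

∑-filter : {A : Set} (f : A → Poly) (b : A → Bool) (xs : List A) →
           ∑ f (filter (λ x → T? (b x)) xs) ≐ ∑ (λ x → if b x then f x else 0P) xs
∑-filter f b []       = ≐-refl
∑-filter f b (x ∷ xs) with b x
... | true  = ⊕-congˡ (f x) (∑-filter f b xs)
... | false = ≐-trans (∑-filter f b xs) (≐-sym (⊕-identityˡ _))

∑-⊕ : {A : Set} (f g : A → Poly) (xs : List A) → ∑ (λ x → f x ⊕ g x) xs ≐ ∑ f xs ⊕ ∑ g xs
∑-⊕ f g []       = ≐-sym (⊕-identityˡ 0P)
∑-⊕ f g (x ∷ xs) =
  ≐-trans (⊕-congˡ (f x ⊕ g x) (∑-⊕ f g xs)) (⊕-interchange (f x) (g x) (∑ f xs) (∑ g xs))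

∑-q· : {A : Set} (f : A → Poly) (xs : List A) → ∑ (λ x → q· f x) xs ≐ q· ∑ f xs
∑-q· f []       = ≐-sym q·-0P
∑-q· f (x ∷ xs) = ≐-trans (⊕-congˡ (q· f x) (∑-q· f xs)) (≐-sym (q·-⊕ (f x) (∑ f xs)))

∑-zero : {A : Set} (xs : List A) → ∑ (λ _ → 0P) xs ≐ 0P
∑-zero []       = ≐-refl
∑-zero (x ∷ xs) = ≐-trans (⊕-congˡ 0P (∑-zero xs)) (⊕-identityˡ 0P)

∑-words-suc : (f : List Bool → Poly) (n : ℕ) →
              ∑ f (words (suc n)) ≐ ∑ (λ w → f (false ∷ w)) (words n) ⊕ ∑ (λ w → f (true ∷ w)) (words n)
∑-words-suc f n = begin
  ∑ f (words (suc n))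
    ≈⟨ ∑-concatMap f (λ w → (false ∷ w) ∷ (true ∷ w) ∷ []) (words n) ⟩
  ∑ (λ w → f (false ∷ w) ⊕ (f (true ∷ w) ⊕ 0P)) (words n)
    ≈⟨ ∑-cong (words n) (λ w → ⊕-congˡ (f (false ∷ w)) (⊕-identityʳ (f (true ∷ w)))) ⟩
  ∑ (λ w → f (false ∷ w) ⊕ f (true ∷ w)) (words n)
    ≈⟨ ∑-⊕ (λ w → f (false ∷ w)) (λ w → f (true ∷ w)) (words n) ⟩
  ∑ (λ w → f (false ∷ w)) (words n) ⊕ ∑ (λ w → f (true ∷ w)) (words n) ∎

∑∑ : ℕ → ℕ → (List Bool → List Bool → Poly) → Poly
∑∑ m n f = ∑ (λ w → ∑ (f w) (words n)) (words m)

∑∑-cong : ∀ m n {f g : List Bool → List Bool → Poly} → (∀ w v → f w v ≐ g w v) → ∑∑ m n f ≐ ∑∑ m n g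
∑∑-cong m n f≐g = ∑-cong (words m) (λ w → ∑-cong (words n) (f≐g w))

∑∑-q· : ∀ m n (f : List Bool → List Bool → Poly) → ∑∑ m n (λ w v → q· f w v) ≐ q· ∑∑ m n f
∑∑-q· m n f = ≐-trans (∑-cong (words m) (λ w → ∑-q· (f w) (words n)))
                      (∑-q· (λ w → ∑ (f w) (words n)) (words m))

∑∑-zero : ∀ m n → ∑∑ m n (λ _ _ → 0P) ≐ 0P
∑∑-zero m n = ≐-trans (∑-cong (words m) (λ _ → ∑-zero (words n))) (∑-zero (words m))

∑∑⟨_,_⟩ : Bool → Bool → ℕ → ℕ → (List Bool → List Bool → Poly) → Poly
∑∑⟨ b , c ⟩ m n f = ∑∑ m n (λ w v → f (b ∷ w) (c ∷ v))

∑∑-suc : ∀ m n (f : List Bool → List Bool → Poly) →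
         ∑∑ (suc m) (suc n) f ≐ (∑∑⟨ false , false ⟩ m n f ⊕ ∑∑⟨ false , true ⟩ m n f)
                                ⊕ (∑∑⟨ true , false ⟩ m n f ⊕ ∑∑⟨ true , true ⟩ m n f)
∑∑-suc m n f = ≐-trans (∑-words-suc (λ w → ∑ (f w) (words (suc n))) m)
                       (⊕-cong (split (λ w → false ∷ w)) (split (λ w → true ∷ w)))
  where
  split : (top : List Bool → List Bool) →
          ∑ (λ w → ∑ (f (top w)) (words (suc n))) (words m)
          ≐ ∑∑ m n (λ w v → f (top w) (false ∷ v)) ⊕ ∑∑ m n (λ w v → f (top w) (true ∷ v))
  split top = ≐-trans (∑-cong (words m) (λ w → ∑-words-suc (f (top w)) n))
                      (∑-⊕ (λ w → ∑ (λ v → f (top w) (false ∷ v)) (words n))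
                           (λ w → ∑ (λ v → f (top w) (true ∷ v)) (words n)) (words m))

∑-fillings-cons : (f : Filling → Poly) (m : ℕ) (ms : List ℕ) →
                  ∑ f (fillings (m ∷ ms)) ≐ ∑ (λ w → ∑ (λ D → f (w ∷ D)) (fillings ms)) (words m)
∑-fillings-cons f m ms = ≐-trans (∑-concatMap f (λ w → map (w ∷_) (fillings ms)) (words m))
                                 (∑-cong (words m) (λ w → ∑-map f (w ∷_) (fillings ms)))

∑-fillings-one : (f : Filling → Poly) (m : ℕ) → ∑ f (fillings (m ∷ [])) ≐ ∑ (λ w → f (w ∷ [])) (words m)
∑-fillings-one f m = ≐-trans (∑-fillings-cons f m [])
                             (∑-cong (words m) (λ w → ⊕-identityʳ (f (w ∷ []))))

∑-fillings-two : (f : Filling → Poly) (m n : ℕ) →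
                 ∑ f (fillings (m ∷ n ∷ [])) ≐ ∑∑ m n (λ w v → f (w ∷ v ∷ []))
∑-fillings-two f m n = ≐-trans (∑-fillings-cons f m (n ∷ []))
                               (∑-cong (words m) (λ w → ∑-fillings-one (λ D → f (w ∷ D)) n))

-- Le-fillings with one or two rows

ones : List Bool → ℕ
ones w = length (filter (λ b → T? b) w)

weight : Filling → Poly
weight D = X ^P countOnes D

leWeight : Filling → Poly
leWeight D = if isLe D then weight D else 0P

F≐∑leWeight : ∀ ls → F ls ≐ ∑ leWeight (fillings ls)
F≐∑leWeight ls = ∑-filter weight isLe (fillings ls)

rowOK-[] : ∀ s j w → rowOK [] s j w ≡ true
rowOK-[] s     j []          = refl
rowOK-[] s     j (true ∷ w)  = rowOK-[] true (suc j) w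
rowOK-[] false j (false ∷ w) = rowOK-[] false (suc j) w
rowOK-[] true  j (false ∷ w) = rowOK-[] true (suc j) w

∑-weight-words : ∀ m → ∑ (λ w → weight (w ∷ [])) (words m) ≐ qint 2 ^P m
∑-weight-words zero    = ⊕-identityʳ 1P
∑-weight-words (suc m) = begin
  ∑ (λ w → weight (w ∷ [])) (words (suc m))
    ≈⟨ ∑-words-suc (λ w → weight (w ∷ [])) m ⟩
  W ⊕ ∑ (λ w → weight ((true ∷ w) ∷ [])) (words m)
    ≈⟨ ⊕-congˡ W (≐-trans (∑-cong (words m) (λ w → X-⊗ (weight (w ∷ []))))
                          (∑-q· (λ w → weight (w ∷ [])) (words m))) ⟩
  [2]· W
    ≈⟨ [2]·-cong (∑-weight-words m) ⟩
  [2]· qint 2 ^P m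
    ≈⟨ ≐-sym (qint2-⊗ (qint 2 ^P m)) ⟩
  qint 2 ^P suc m ∎
  where
  W : Poly
  W = ∑ (λ w → weight (w ∷ [])) (words m)

F-one-row : ∀ m → F (m ∷ []) ≐ qint 2 ^P m
F-one-row m = begin
  F (m ∷ [])                              ≈⟨ F≐∑leWeight (m ∷ []) ⟩
  ∑ leWeight (fillings (m ∷ []))          ≈⟨ ∑-fillings-one leWeight m ⟩
  ∑ (λ w → leWeight (w ∷ [])) (words m)   ≈⟨ ∑-cong (words m) first-row-is-Le ⟩
  ∑ (λ w → weight (w ∷ [])) (words m)     ≈⟨ ∑-weight-words m ⟩
  qint 2 ^P m                             ∎
  where
  first-row-is-Le : ∀ w → leWeight (w ∷ []) ≐ weight (w ∷ [])
  first-row-is-Le w rewrite rowOK-[] false 0 w = ≐-refl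

rowOK-shift : ∀ b w s j v → rowOK ((b ∷ w) ∷ []) s (suc j) v ≡ rowOK (w ∷ []) s j v
rowOK-shift b w s j []          = refl
rowOK-shift b w s j (true ∷ v)  = rowOK-shift b w true (suc j) v
rowOK-shift b w s j (false ∷ v) =
  cong (λ ok → not (s ∧ (entry w j ∨ false)) ∧ ok) (rowOK-shift b w s (suc j) v)

pairWeight : Bool → List Bool → List Bool → Poly
pairWeight s w v = if rowOK (w ∷ []) s 0 v then weight (w ∷ v ∷ []) else 0P

pairSum : Bool → ℕ → ℕ → Poly
pairSum s m n = ∑∑ m n (pairWeight s)

F-two-rows : ∀ m n → F (m ∷ n ∷ []) ≐ pairSum false m n
F-two-rows m n = ≐-trans (F≐∑leWeight (m ∷ n ∷ []))
                         (≐-trans (∑-fillings-two leWeight m n) (∑∑-cong m n second-row-decides))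
  where
  second-row-decides : ∀ w v → leWeight (w ∷ v ∷ []) ≐ pairWeight false w v
  second-row-decides w v
    rewrite rowOK-[] false 0 w | Bool.∧-identityʳ (rowOK (w ∷ []) false 0 v) = ≐-refl

if-X^P-suc : ∀ c k {k'} → k' ≡ suc k → (if c then X ^P k' else 0P) ≐ q· (if c then X ^P k else 0P)
if-X^P-suc true  k refl = X-⊗ (X ^P k)
if-X^P-suc false k _    = ≐-sym q·-0P

pairWeight-00 : ∀ s w v → pairWeight s (false ∷ w) (false ∷ v) ≐ pairWeight s w v
pairWeight-00 false w v rewrite rowOK-shift false w false 0 v = ≐-refl
pairWeight-00 true  w v rewrite rowOK-shift false w true 0 v  = ≐-refl

pairWeight-01 : ∀ s w v → pairWeight s (false ∷ w) (true ∷ v) ≐ q· pairWeight true w v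
pairWeight-01 s w v rewrite rowOK-shift false w true 0 v =
  if-X^P-suc (rowOK (w ∷ []) true 0 v) (countOnes (w ∷ v ∷ [])) (ℕ.+-suc (ones w) (ones v + 0))

pairWeight-false-10 : ∀ w v → pairWeight false (true ∷ w) (false ∷ v) ≐ q· pairWeight false w v
pairWeight-false-10 w v rewrite rowOK-shift true w false 0 v =
  if-X^P-suc (rowOK (w ∷ []) false 0 v) (countOnes (w ∷ v ∷ [])) refl

-- The only column excluded by the Le condition.
pairWeight-true-10 : ∀ w v → pairWeight true (true ∷ w) (false ∷ v) ≐ 0P
pairWeight-true-10 w v = ≐-refl

pairWeight-11 : ∀ s w v → pairWeight s (true ∷ w) (true ∷ v) ≐ q· q· pairWeight true w v
pairWeight-11 s w v rewrite rowOK-shift true w true 0 v =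
  ≐-trans (if-X^P-suc ok (countOnes (w ∷ (true ∷ v) ∷ [])) refl)
          (q·-cong (if-X^P-suc ok (countOnes (w ∷ v ∷ [])) (ℕ.+-suc (ones w) (ones v + 0))))
  where
  ok : Bool
  ok = rowOK (w ∷ []) true 0 v

pairSum-00 : ∀ s m n → ∑∑⟨ false , false ⟩ m n (pairWeight s) ≐ pairSum s m n
pairSum-00 s m n = ∑∑-cong m n (pairWeight-00 s)

pairSum-01 : ∀ s m n → ∑∑⟨ false , true ⟩ m n (pairWeight s) ≐ q· pairSum true m n
pairSum-01 s m n = ≐-trans (∑∑-cong m n (pairWeight-01 s)) (∑∑-q· m n (pairWeight true))

pairSum-false-10 : ∀ m n → ∑∑⟨ true , false ⟩ m n (pairWeight false) ≐ q· pairSum false m n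
pairSum-false-10 m n = ≐-trans (∑∑-cong m n pairWeight-false-10) (∑∑-q· m n (pairWeight false))

pairSum-true-10 : ∀ m n → ∑∑⟨ true , false ⟩ m n (pairWeight true) ≐ 0P
pairSum-true-10 m n = ≐-trans (∑∑-cong m n pairWeight-true-10) (∑∑-zero m n)

pairSum-11 : ∀ s m n → ∑∑⟨ true , true ⟩ m n (pairWeight s) ≐ q· q· pairSum true m n
pairSum-11 s m n = ≐-trans (∑∑-cong m n (pairWeight-11 s))
  (≐-trans (∑∑-q· m n (λ w v → q· pairWeight true w v)) (q·-cong (∑∑-q· m n (pairWeight true))))

pairSum-zero : ∀ s m → pairSum s m 0 ≐ qint 2 ^P m
pairSum-zero s m = ≐-trans (∑-cong (words m) (λ w → ⊕-identityʳ (weight (w ∷ [])))) (∑-weight-words m)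

pairSum-true-suc : ∀ m n → pairSum true (suc m) (suc n) ≐ [3]· pairSum true m n
pairSum-true-suc m n = begin
  pairSum true (suc m) (suc n)
    ≈⟨ ∑∑-suc m n (pairWeight true) ⟩
  (∑∑⟨ false , false ⟩ m n (pairWeight true) ⊕ ∑∑⟨ false , true ⟩ m n (pairWeight true))
  ⊕ (∑∑⟨ true , false ⟩ m n (pairWeight true) ⊕ ∑∑⟨ true , true ⟩ m n (pairWeight true))
    ≈⟨ ⊕-cong (⊕-cong (pairSum-00 true m n) (pairSum-01 true m n))
              (⊕-cong (pairSum-true-10 m n) (pairSum-11 true m n)) ⟩
  (U ⊕ q· U) ⊕ (0P ⊕ q· q· U)
    ≈⟨ ⊕-congˡ ([2]· U) (⊕-identityˡ (q· q· U)) ⟩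
  [3]· U ∎
  where
  U : Poly
  U = pairSum true m n

pairSum-false-suc : ∀ m n → pairSum false (suc m) (suc n) ≐ [2]· (pairSum false m n ⊕ q· pairSum true m n)
pairSum-false-suc m n = begin
  pairSum false (suc m) (suc n)
    ≈⟨ ∑∑-suc m n (pairWeight false) ⟩
  (∑∑⟨ false , false ⟩ m n (pairWeight false) ⊕ ∑∑⟨ false , true ⟩ m n (pairWeight false))
  ⊕ (∑∑⟨ true , false ⟩ m n (pairWeight false) ⊕ ∑∑⟨ true , true ⟩ m n (pairWeight false))
    ≈⟨ ⊕-cong (⊕-cong (pairSum-00 false m n) (pairSum-01 false m n))
              (⊕-cong (pairSum-false-10 m n) (pairSum-11 false m n)) ⟩
  (U ⊕ q· V) ⊕ (q· U ⊕ q· q· V)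
    ≈⟨ ⊕-congˡ (U ⊕ q· V) (≐-sym (q·-⊕ U (q· V))) ⟩
  [2]· (U ⊕ q· V) ∎
  where
  U V : Poly
  U = pairSum false m n
  V = pairSum true m n

pairSum-true-closed : ∀ k d → pairSum true (k + d) k ≐ qint 2 ^P d ⊗ qint 3 ^P k
pairSum-true-closed zero    d = ≐-trans (pairSum-zero true d) (≐-sym (⊗-identityʳ (qint 2 ^P d)))
pairSum-true-closed (suc k) d = begin
  pairSum true (suc (k + d)) (suc k)  ≈⟨ pairSum-true-suc (k + d) k ⟩
  [3]· pairSum true (k + d) k         ≈⟨ [3]·-cong (pairSum-true-closed k d) ⟩
  [3]· (qint 2 ^P d ⊗ qint 3 ^P k)    ≈⟨ ≐-sym (⊗-qint3^suc (qint 2 ^P d) k) ⟩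
  qint 2 ^P d ⊗ qint 3 ^P suc k       ∎

pairSum-false-closed : ∀ k d → qint 2 ^P (k + d) ⊕ q· pairSum false (k + d) k ≐ qint 2 ^P suc d ⊗ qint 3 ^P k
pairSum-false-closed zero    d = begin
  qint 2 ^P d ⊕ q· pairSum false d 0   ≈⟨ ⊕-congˡ (qint 2 ^P d) (q·-cong (pairSum-zero false d)) ⟩
  [2]· qint 2 ^P d                     ≈⟨ ≐-sym (qint2-⊗ (qint 2 ^P d)) ⟩
  qint 2 ^P suc d                      ≈⟨ ≐-sym (⊗-identityʳ (qint 2 ^P suc d)) ⟩
  qint 2 ^P suc d ⊗ 1P                 ∎
pairSum-false-closed (suc k) d = begin
  qint 2 ^P suc (k + d) ⊕ q· pairSum false (suc (k + d)) (suc k)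
    ≈⟨ ⊕-cong (qint2-⊗ P) (q·-cong (pairSum-false-suc (k + d) k)) ⟩
  [2]· P ⊕ q· [2]· (U ⊕ q· V)
    ≈⟨ ⊕-congˡ ([2]· P) (≐-trans (q·-[2]· (U ⊕ q· V)) ([2]·-cong (q·-⊕ U (q· V)))) ⟩
  [2]· P ⊕ [2]· (q· U ⊕ q· q· V)
    ≈⟨ ≐-sym ([2]·-⊕ P (q· U ⊕ q· q· V)) ⟩
  [2]· (P ⊕ (q· U ⊕ q· q· V))
    ≈⟨ [2]·-cong (≐-sym (⊕-assoc P (q· U) (q· q· V))) ⟩
  [2]· ((P ⊕ q· U) ⊕ q· q· V)
    ≈⟨ [2]·-cong (⊕-cong (pairSum-false-closed k d) (q·-cong (q·-cong (pairSum-true-closed k d)))) ⟩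
  [2]· (qint 2 ^P suc d ⊗ Q ⊕ q· q· M)
    ≈⟨ [2]·-cong (⊕-congʳ (q· q· M) (qint2^suc-⊗ d Q)) ⟩
  [2]· ([2]· M ⊕ q· q· M)
    ≈⟨ ≐-sym ([3]·[2]· M) ⟩
  [3]· [2]· M
    ≈⟨ [3]·-cong (≐-sym (qint2^suc-⊗ d Q)) ⟩
  [3]· (qint 2 ^P suc d ⊗ Q)
    ≈⟨ ≐-sym (⊗-qint3^suc (qint 2 ^P suc d) k) ⟩
  qint 2 ^P suc d ⊗ qint 3 ^P suc k ∎
  where
  P U V Q M : Poly
  P = qint 2 ^P (k + d)
  U = pairSum false (k + d) k
  V = pairSum true (k + d) k
  Q = qint 3 ^P k
  M = qint 2 ^P d ⊗ Q

F-two-rows-closed : ∀ k d → qint 2 ^P (k + d) ⊕ q· F (k + d ∷ k ∷ []) ≐ qint 2 ^P suc d ⊗ qint 3 ^P k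
F-two-rows-closed k d =
  ≐-trans (⊕-congˡ (qint 2 ^P (k + d)) (q·-cong (F-two-rows (k + d) k))) (pairSum-false-closed k d)

proposition4p3 : (l₁ l₂ : ℕ) → l₁ ≥ l₂ →
    (F (l₁ ∷ []) ≐ qint 2 ^P l₁)
    × (ι (F (l₁ ∷ l₂ ∷ []))
        ≈L (-L (qinv *L ι (qint 2 ^P l₁)))
           +L qinv *L ι ((qint 2 ^P (l₁ ∸ l₂ + 1)) ⊗ (qint 3 ^P l₂)))
proposition4p3 l₁ l₂ l₁≥l₂ with ℕ.m≤n⇒∃[o]m+o≡n l₁≥l₂
... | d , refl = F-one-row (l₂ + d) , a⊕q·p≐b⇒p≈q⁻¹[b-a] _ _ _ (begin
  qint 2 ^P (l₂ + d) ⊕ q· F (l₂ + d ∷ l₂ ∷ [])  ≈⟨ F-two-rows-closed l₂ d ⟩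
  qint 2 ^P suc d ⊗ qint 3 ^P l₂                ≡⟨ cong (λ e → qint 2 ^P e ⊗ qint 3 ^P l₂) exponent ⟩
  qint 2 ^P (l₂ + d ∸ l₂ + 1) ⊗ qint 3 ^P l₂    ∎)
  where
  exponent : suc d ≡ l₂ + d ∸ l₂ + 1
  exponent = trans (ℕ.+-comm 1 d) (cong (_+ 1) (sym (ℕ.m+n∸m≡n l₂ d)))
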